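{- Let $p$ be a prime and $s,t\in\mathbb{Z}_p$. Then $f_s\mathrel{E_{\mathrm{fin}}}f_t$, where $f_u(k)=v_p(k-u)$ for $k\in\mathbb{Z}$.
   Context: $\mathbb{Z}_p$ denotes the $p$-adic integers and $v_p$ the $p$-adic valuation (with $v_p(0)=\infty$). For $f,g\colon\mathbb{Z}\to\mathbb{N}\cup\{\infty\}$, $f\mathrel{E_{\mathbb{Z}}}g$ means there is $n\in\mathbb{Z}$ with $f(m)=g(m+n)$ for all $m\in\mathbb{Z}$, and $f\mathrel{E_{\mathrm{fin}}}g$ means $\min(\ell,f)\mathrel{E_{\mathbb{Z}}}\min(\ell,g)$ for every $\ell\in\mathbb{N}$. -}

module Defs where

open import Data.Nat as ℕ using (ℕ; zero; suc; _^_)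
open import Data.Nat.Divisibility using (_∣?_)
open import Data.Fin using (Fin; toℕ)
open import Data.Bool using (Bool; true; false; if_then_else_)
open import Data.Integer as ℤ using (ℤ; +_; ∣_∣)
open import Data.Product using (∃)
open import Relation.Binary.PropositionalEquality using (_≡_)
open import Relation.Nullary.Decidable using (⌊_⌋)

-- p-adic integers, represented by their p-adic digit expansions
-- u = Σ_{i ≥ 0} digit i * p^i  with digit i ∈ {0,…,p-1}.
record Zp (p : ℕ) : Set where
  constructor padic
  field
    digit : ℕ → Fin p
open Zp public

residue : ∀ {p} → Zp p → ℕ → ℕ
residue {p} u zero    = 0
residue {p} u (suc n) = residue u n ℕ.+ toℕ (digit u n) ℕ.* p ^ n

-- ℕ ∪ {∞}, represented as the sequence of answers to "is the value ≥ j+1 ?"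
-- (j = 0,1,2,…).  The value is the number of leading 'true's (∞ if all true).
ℕ∞ : Set
ℕ∞ = ℕ → Bool

min∞ : ℕ → ℕ∞ → ℕ
min∞ zero    x = 0
min∞ (suc ℓ) x = if x 0 then suc (min∞ ℓ (λ j → x (suc j))) else 0

-- v_p(k - u) for k ∈ ℤ, u ∈ ℤ_p :  v_p(k - u) ≥ j+1  iff  p^(j+1) ∣ k - (u mod p^(j+1))
vp-diff : (p : ℕ) → ℤ → Zp p → ℕ∞
vp-diff p k u j = ⌊ p ^ suc j ∣? ∣ k ℤ.- + residue u (suc j) ∣ ⌋

f : (p : ℕ) → Zp p → ℤ → ℕ∞
f p u k = vp-diff p k u

_E-ℤ_ : (ℤ → ℕ) → (ℤ → ℕ) → Set
F E-ℤ G = ∃ λ (n : ℤ) → (m : ℤ) → F m ≡ G (m ℤ.+ n)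

_E-fin_ : (ℤ → ℕ∞) → (ℤ → ℕ∞) → Set
F E-fin G = (ℓ : ℕ) → (λ m → min∞ ℓ (F m)) E-ℤ (λ m → min∞ ℓ (G m))

-- The truncation min(ℓ, v_p(k − u)) only asks whether p^(j+1) divides k − u for j < ℓ, and
-- that depends only on k − (u mod p^ℓ), because u mod p^ℓ ≡ u mod p^(j+1) (mod p^(j+1)).
-- Hence translating k by (t mod p^ℓ) − (s mod p^ℓ) turns the truncation of f_s into that of f_t.
module Submission where

open import Defs
open import Data.Nat using (ℕ)
open import Data.Nat.Primality using (Prime)

open import Data.Nat as ℕ using (zero; suc; _^_; _<_; _≤′_; ≤′-refl; ≤′-step; s≤s; z≤n)
open import Data.Nat.Properties using (≤⇒≤′)
import Data.Nat.Divisibility as ℕ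
open import Data.Integer using (ℤ; +_; ∣_∣; _+_; _-_; _*_)
open import Data.Integer.Properties using (pos-+; pos-*; +-inverseʳ)
open import Data.Integer.Divisibility.Signed
  using (_∣_; divides; ∣ᵤ⇒∣; ∣⇒∣ᵤ; ∣m∣n⇒∣m+n; ∣m∣n⇒∣m-n; ∣m+n∣n⇒∣m; ∣n⇒∣m*n)
open import Data.Integer.Tactic.RingSolver using (solve-∀)
open import Data.Fin using (toℕ)
open import Data.Bool using (true; false)
open import Data.Product using (_,_)
open import Function.Bundles using (_⇔_; mk⇔)
open import Relation.Binary.PropositionalEquality using (_≡_; refl; cong; subst; sym; trans; module ≡-Reasoning)
open import Relation.Nullary using (Dec)
open import Relation.Nullary.Decidable using (isYes; isYes≗does; does-⇔)

min∞-cong : ∀ ℓ {x y : ℕ∞} → (∀ {j} → j < ℓ → x j ≡ y j) → min∞ ℓ x ≡ min∞ ℓ y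
min∞-cong zero    x≗y = refl
min∞-cong (suc ℓ) {x} {y} x≗y rewrite x≗y (s≤s z≤n) with y 0
... | true  = cong suc (min∞-cong ℓ (λ j<ℓ → x≗y (s≤s j<ℓ)))
... | false = refl

^-monoʳ-∣ : ∀ p {a b} → a ≤′ b → p ^ a ℕ.∣ p ^ b
^-monoʳ-∣ p ≤′-refl       = ℕ.∣-refl
^-monoʳ-∣ p (≤′-step a≤b) = ℕ.∣n⇒∣m*n p (^-monoʳ-∣ p a≤b)

residue-suc : ∀ {p} (u : Zp p) n →
              + residue u (suc n) ≡ + residue u n + + toℕ (digit u n) * + (p ^ n)
residue-suc {p} u n = begin
  + (residue u n ℕ.+ toℕ (digit u n) ℕ.* p ^ n)     ≡⟨ pos-+ (residue u n) _ ⟩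
  + residue u n + + (toℕ (digit u n) ℕ.* p ^ n)     ≡⟨ cong (_+_ (+ residue u n)) (pos-* (toℕ (digit u n)) _) ⟩
  + residue u n + + toℕ (digit u n) * + (p ^ n)     ∎
  where open ≡-Reasoning

residue-congruent : ∀ {p} (u : Zp p) {a b} → a ≤′ b →
                    + (p ^ a) ∣ + residue u b - + residue u a
residue-congruent u {a} ≤′-refl = divides (+ 0) (+-inverseʳ (+ residue u a))
residue-congruent {p} u {a} (≤′-step {b} a≤b) =
  subst (+ (p ^ a) ∣_) (sym regroup)
    (∣m∣n⇒∣m+n (residue-congruent u a≤b) (∣n⇒∣m*n d (∣ᵤ⇒∣ (^-monoʳ-∣ p a≤b))))
  where
  d = + toℕ (digit u b)
  swap : ∀ x y z → x + y - z ≡ x - z + y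
  swap = solve-∀
  regroup : + residue u (suc b) - + residue u a ≡ (+ residue u b - + residue u a) + d * + (p ^ b)
  regroup rewrite residue-suc u b = swap (+ residue u b) (d * + (p ^ b)) (+ residue u a)

∣n⇒∣∣m∣⇔∣∣m+n∣ : ∀ {k m n} → + k ∣ n → (k ℕ.∣ ∣ m ∣ ⇔ k ℕ.∣ ∣ m + n ∣)
∣n⇒∣∣m∣⇔∣∣m+n∣ {k} {m} {n} k∣n =
  mk⇔ (λ k∣m → ∣⇒∣ᵤ (∣m∣n⇒∣m+n (∣ᵤ⇒∣ {i = m} k∣m) k∣n))
      (λ k∣m+n → ∣⇒∣ᵤ {i = m} (∣m+n∣n⇒∣m (∣ᵤ⇒∣ {i = m + n} k∣m+n) k∣n))

isYes-⇔ : ∀ {A B : Set} → A ⇔ B → (a? : Dec A) (b? : Dec B) → isYes a? ≡ isYes b?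
isYes-⇔ A⇔B a? b? = trans (isYes≗does a?) (trans (does-⇔ A⇔B a? b?) (sym (isYes≗does b?)))

offset : ∀ {p} → Zp p → Zp p → ℕ → ℤ
offset s t ℓ = + residue t ℓ - + residue s ℓ

vp-diff-offset : ∀ {p} (s t : Zp p) {j ℓ} → j < ℓ → ∀ m →
                 vp-diff p m s j ≡ vp-diff p (m + offset s t ℓ) t j
vp-diff-offset {p} s t {j} {ℓ} j<ℓ m =
  isYes-⇔ (subst (λ y → q ℕ.∣ ∣ m - S ∣ ⇔ q ℕ.∣ ∣ y ∣) (sym shape)
                 (∣n⇒∣∣m∣⇔∣∣m+n∣ {m = m - S} q∣Δ)) _ _
  where
  q = p ^ suc j
  S = + residue s (suc j)
  T = + residue t (suc j)
  Δ = (+ residue t ℓ - T) - (+ residue s ℓ - S)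
  q∣Δ : + q ∣ Δ
  q∣Δ = ∣m∣n⇒∣m-n (residue-congruent t (≤⇒≤′ j<ℓ)) (residue-congruent s (≤⇒≤′ j<ℓ))
  regroup : ∀ k a b c d → k + (b - a) - d ≡ (k - c) + ((b - d) - (a - c))
  regroup = solve-∀
  shape : m + offset s t ℓ - T ≡ (m - S) + Δ
  shape = regroup m (+ residue s ℓ) (+ residue t ℓ) S T

lemma6p3 : (p : ℕ) → Prime p → (s t : Zp p) → f p s E-fin f p t
lemma6p3 p _ s t ℓ = offset s t ℓ , λ m → min∞-cong ℓ (λ j<ℓ → vp-diff-offset s t j<ℓ m)
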